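{- Let $a$, $b$ and $c$ be positive integers. Then $$\lim_{n \to \infty} h\!\left(\frac{a}{b}\,n! + c\right) = h(c) \quad\text{and}\quad \lim_{n \to \infty} h\!\left(\frac{a}{b}\,n! - c\right) = h(c).$$
   Context: $\sigma(m)$ is the sum of the positive divisors of a positive integer $m$ and $h(m)=\sigma(m)/m$. For all sufficiently large $n$, $\frac{a}{b}n!\pm c$ is a positive integer, and the limits are taken over such $n$. -}

module Defs where

open import Data.Nat using (ℕ; zero; suc; _+_; _*_; _∸_; _≤_; _<_; NonZero)
open import Data.Nat.Divisibility using (_∣?_)
open import Data.List using (List; filterᵇ; upTo; map)
open import Data.Nat.ListAction using (sum)
open import Data.Integer using (+_)
open import Data.Rational using (ℚ; 0ℚ; _/_)
open import Relation.Nullary.Decidable using (⌊_⌋)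

σ : ℕ → ℕ
σ m = sum (filterᵇ (λ d → ⌊ d ∣? m ⌋) (map suc (upTo m)))

-- h m = σ m / m for m ≥ 1 (junk value 0 at m = 0, never used)
h : ℕ → ℚ
h zero    = 0ℚ
h (suc k) = (+ σ (suc k)) / suc k

{-# OPTIONS --safe #-}
-- Write n! = K·b·c, possible as soon as n ≥ b + c. Then a·n!/b ± c = c·u with u = aK ± 1
-- coprime to K, so every prime factor of u exceeds n − bc. From u·σ(c) ≤ σ(cu) ≤ σ(c)·σ(u)
-- we get h(c) ≤ h(cu) ≤ h(c)·h(u), so it suffices that h(u) → 1. Over the distinct primes p
-- of u, h(u) ≤ ∏ p/(p − 1), and this product tends to 1: the primes all exceed T ≈ n, by
-- Chebyshev's bound ∏_{y<p≤2y} p ≤ (2y choose y) ≤ 4^y a dyadic block (2^k, 2^(k+1)] holds at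
-- most 2^(k+1)/k of them, and there are at most log₂ u / log₂ T ≈ n of them in total.

module Submission where

open import Data.Bool using (T?; true; false; if_then_else_)
open import Data.Empty using (⊥-elim)
open import Data.Integer as ℤ using (+[1+_]; _⊖_)
import Data.Integer.Properties as ℤ
open import Data.List using (List; []; _∷_; _++_; map; filter; filterᵇ; upTo; length; cartesianProductWith)
open import Data.List.Membership.Propositional using (_∈_)
open import Data.List.Membership.Propositional.Properties
open import Data.List.Properties using (length-filter; length-map; length-upTo)
open import Data.List.Relation.Binary.Permutation.Propositional.Properties using (shift)
open import Data.List.Relation.Binary.Subset.Propositional using (_⊆_)
open import Data.List.Relation.Unary.All as All using (All; []; _∷_)
import Data.List.Relation.Unary.All.Properties as All
open import Data.List.Relation.Unary.AllPairs using ([]; _∷_)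
open import Data.List.Relation.Unary.Any using (here; there)
open import Data.List.Relation.Unary.Unique.Propositional using (Unique)
import Data.List.Relation.Unary.Unique.Propositional.Properties as Unique
open import Data.Nat hiding (∣_-_∣)
open import Data.Nat.Combinatorics using (_C_; nCk+nC[k+1]≡[n+1]C[k+1]; k![n∸k]!∣n!)
open import Data.Nat.Combinatorics.Specification using (nCk≡n!/k![n-k]!; k>n⇒nCk≡0)
open import Data.Nat.Coprimality using (Coprime; coprime-/gcd; coprime-divisor)
open import Data.Nat.DivMod using (_/_; m*[n/m]≡n; m/n*n≡m; m*n/n≡m)
open import Data.Nat.Divisibility
open import Data.Nat.GCD using (gcd; gcd[m,n]∣m; gcd[m,n]∣n; gcd[m,n]≢0)
open import Data.Nat.Induction using (<-wellFounded)
open import Data.Nat.ListAction using (sum; product)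
open import Data.Nat.ListAction.Properties using (sum-++; sum-↭)
open import Data.Nat.Logarithm using (⌊log₂_⌋; ⌊log₂⌋-mono-≤; ⌊log₂[2^n]⌋≡n)
open import Data.Nat.Logarithm.Core using (⌊log2⌋-acc-irrelevant)
open import Data.Nat.Primality
open import Data.Nat.Primality.Factorisation using (factorise)
open import Data.Nat.Properties
open import Data.Nat.Solver using (module +-*-Solver)
open import Data.Product using (∃; ∃₂; ∃-syntax; _×_; _,_; proj₁; proj₂)
open import Data.Rational as ℚ using (ℚ; mkℚ; 0ℚ; _-_; toℚᵘ; ↧ₙ_) renaming (_<_ to _<ℚ_)
import Data.Rational.Properties as ℚ
open import Data.Rational.Unnormalised as ℚᵘ using (mkℚᵘ; _≃_)
import Data.Rational.Unnormalised.Properties as ℚᵘ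
open import Data.Sum using (inj₁; inj₂)
open import Defs
open import Function using (_∘_)
open import Induction.WellFounded using (Acc; acc)
open import Relation.Binary.PropositionalEquality hiding (J)
open import Relation.Nullary using (yes; no)
open import Relation.Nullary.Decidable using (⌊_⌋; toWitness; fromWitness)
open +-*-Solver using (solve; _:+_; _:*_; _:=_; con)

sum-map-*ˡ : ∀ k xs → sum (map (k *_) xs) ≡ k * sum xs
sum-map-*ˡ k []       = sym (*-zeroʳ k)
sum-map-*ˡ k (x ∷ xs) = trans (cong (k * x +_) (sum-map-*ˡ k xs)) (sym (*-distribˡ-+ k x (sum xs)))

sum-cartesianProductWith-* : ∀ xs ys → sum (cartesianProductWith _*_ xs ys) ≡ sum xs * sum ys
sum-cartesianProductWith-* []       ys = refl
sum-cartesianProductWith-* (x ∷ xs) ys = begin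
  sum (map (x *_) ys ++ cartesianProductWith _*_ xs ys)       ≡⟨ sum-++ (map (x *_) ys) _ ⟩
  sum (map (x *_) ys) + sum (cartesianProductWith _*_ xs ys)  ≡⟨ cong₂ _+_ (sum-map-*ˡ x ys) (sum-cartesianProductWith-* xs ys) ⟩
  x * sum ys + sum xs * sum ys                                ≡⟨ *-distribʳ-+ (sum ys) x (sum xs) ⟨
  (x + sum xs) * sum ys                                       ∎
  where open ≡-Reasoning

sum-mono-⊆ : ∀ {xs} ys → Unique xs → xs ⊆ ys → sum xs ≤ sum ys
sum-mono-⊆ {[]}     ys _              _     = z≤n
sum-mono-⊆ {x ∷ xs} ys (x∉xs ∷ xs-uniq) xs⊆ys with ∈-∃++ (xs⊆ys (here refl))
... | ys₁ , ys₂ , refl = begin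
  x + sum xs               ≤⟨ +-monoʳ-≤ x (sum-mono-⊆ (ys₁ ++ ys₂) xs-uniq xs⊆ys₁++ys₂) ⟩
  sum (x ∷ ys₁ ++ ys₂)     ≡⟨ sum-↭ (shift x ys₁ ys₂) ⟨
  sum (ys₁ ++ x ∷ ys₂)     ∎
  where
  open ≤-Reasoning
  xs⊆ys₁++ys₂ : xs ⊆ ys₁ ++ ys₂
  xs⊆ys₁++ys₂ z∈xs with ∈-++⁻ ys₁ (xs⊆ys (there z∈xs))
  ... | inj₁ z∈ys₁         = ∈-++⁺ˡ z∈ys₁
  ... | inj₂ (here refl)   = ⊥-elim (All.lookup x∉xs z∈xs refl)
  ... | inj₂ (there z∈ys₂) = ∈-++⁺ʳ ys₁ z∈ys₂

sum≤length*max : ∀ {n} xs → All (_≤ n) xs → sum xs ≤ length xs * n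
sum≤length*max []       []             = z≤n
sum≤length*max (x ∷ xs) (x≤n ∷ xs≤n) = +-mono-≤ x≤n (sum≤length*max xs xs≤n)

-- σ m unfolds definitionally to sum (divisors m).
divisors : ℕ → List ℕ
divisors m = filterᵇ (λ d → ⌊ d ∣? m ⌋) (map suc (upTo m))

divisors-unique : ∀ m → Unique (divisors m)
divisors-unique m = Unique.filter⁺ _ (Unique.map⁺ suc-injective (Unique.upTo⁺ m))

∈-divisors⁺ : ∀ {d m} → 0 < m → d ∣ m → d ∈ divisors m
∈-divisors⁺ {zero}  m>0 0∣m = ⊥-elim (<⇒≢ m>0 (sym (0∣⇒≡0 0∣m)))
∈-divisors⁺ {suc d} m>0 d∣m =
  ∈-filter⁺ _ (∈-map⁺ suc (∈-upTo⁺ (∣⇒≤ {{>-nonZero m>0}} d∣m))) (fromWitness d∣m)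

∈-divisors⁻ : ∀ m {d} → d ∈ divisors m → d ∣ m
∈-divisors⁻ m d∈ = toWitness (proj₂ (∈-filter⁻ (λ d → T? ⌊ d ∣? m ⌋) {xs = map suc (upTo m)} d∈))

∈-divisors⇒∈1+upTo : ∀ m {d} → d ∈ divisors m → ∃ λ i → i ∈ upTo m × d ≡ suc i
∈-divisors⇒∈1+upTo m d∈ = ∈-map⁻ suc (proj₁ (∈-filter⁻ _ {xs = map suc (upTo m)} d∈))

∈-divisors⇒0< : ∀ m {d} → d ∈ divisors m → 0 < d
∈-divisors⇒0< m d∈ with ∈-divisors⇒∈1+upTo m d∈
... | _ , _ , refl = z<s

∈-divisors⇒≤ : ∀ m {d} → d ∈ divisors m → d ≤ m
∈-divisors⇒≤ m d∈ with ∈-divisors⇒∈1+upTo m d∈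
... | _ , i∈ , refl = ∈-upTo⁻ i∈

∣-*-factorise : ∀ {d m n} → 0 < m → d ∣ m * n → ∃₂ λ g e → g ∣ m × e ∣ n × d ≡ g * e
∣-*-factorise {d} {m} {n} m>0 d∣mn = g , d / g , gcd[m,n]∣n d m , d/g∣n , sym (m*[n/m]≡n (gcd[m,n]∣m d m))
  where
  g = gcd d m
  instance
    g≢0 : NonZero g
    g≢0 = ≢-nonZero (gcd[m,n]≢0 d m (inj₂ (≢-nonZero⁻¹ m {{>-nonZero m>0}})))
  g*d/g∣g*[m/g*n] : g * (d / g) ∣ g * (m / g * n)
  g*d/g∣g*[m/g*n] = subst₂ _∣_ (sym (m*[n/m]≡n (gcd[m,n]∣m d m)))
    (trans (cong (_* n) (sym (m*[n/m]≡n (gcd[m,n]∣n d m)))) (*-assoc g _ n)) d∣mn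
  d/g∣n : d / g ∣ n
  d/g∣n = coprime-divisor (coprime-/gcd d m) (*-cancelˡ-∣ g g*d/g∣g*[m/g*n])

σ[m*n]≤σ[m]*σ[n] : ∀ m n → 0 < m → 0 < n → σ (m * n) ≤ σ m * σ n
σ[m*n]≤σ[m]*σ[n] m n m>0 n>0 = begin
  sum (divisors (m * n))                                   ≤⟨ sum-mono-⊆ _ (divisors-unique (m * n)) split ⟩
  sum (cartesianProductWith _*_ (divisors m) (divisors n)) ≡⟨ sum-cartesianProductWith-* (divisors m) (divisors n) ⟩
  σ m * σ n                                                ∎
  where
  open ≤-Reasoning
  split : divisors (m * n) ⊆ cartesianProductWith _*_ (divisors m) (divisors n)
  split d∈ with ∣-*-factorise m>0 (∈-divisors⁻ (m * n) d∈)
  ... | g , e , g∣m , e∣n , refl =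
    ∈-cartesianProductWith⁺ _*_ (∈-divisors⁺ m>0 g∣m) (∈-divisors⁺ n>0 e∣n)

n*σ[m]≤σ[m*n] : ∀ m n → 0 < m → 0 < n → n * σ m ≤ σ (m * n)
n*σ[m]≤σ[m*n] m n m>0 n>0 = begin
  n * σ m                   ≡⟨ sum-map-*ˡ n (divisors m) ⟨
  sum (map (n *_) (divisors m)) ≤⟨ sum-mono-⊆ _ (Unique.map⁺ (*-cancelˡ-≡ _ _ n {{>-nonZero n>0}}) (divisors-unique m)) scale ⟩
  σ (m * n)                 ∎
  where
  open ≤-Reasoning
  scale : map (n *_) (divisors m) ⊆ divisors (m * n)
  scale nd∈ with ∈-map⁻ (n *_) nd∈
  ... | d , d∈ , refl = ∈-divisors⁺ (*-mono-< m>0 n>0) (subst (n * d ∣_) (*-comm n m) (*-monoʳ-∣ n (∈-divisors⁻ m d∈)))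

σ[n]≤n*n : ∀ n → σ n ≤ n * n
σ[n]≤n*n n = begin
  σ n                        ≤⟨ sum≤length*max (divisors n) (All.tabulate (∈-divisors⇒≤ n)) ⟩
  length (divisors n) * n    ≤⟨ *-monoˡ-≤ n (length-filter _ (map suc (upTo n))) ⟩
  length (map suc (upTo n)) * n ≡⟨ cong (_* n) (trans (length-map suc (upTo n)) (length-upTo n)) ⟩
  n * n                      ∎
  where
  open ≤-Reasoning

prime>1 : ∀ {p} → Prime p → 1 < p
prime>1 {p} pp = nonTrivial⇒n>1 p {{prime⇒nonTrivial pp}}

∃prime∣ : ∀ {n} → 1 < n → ∃ λ p → Prime p × p ∣ n
∃prime∣ {n} n>1 with factorise n {{>-nonZero (<-trans z<s n>1)}}
... | record { factors = [] ; isFactorisation = n≡1 } = ⊥-elim (<⇒≢ n>1 (sym n≡1))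
... | record { factors = p ∷ ps ; isFactorisation = n≡p*∏ps ; factorsPrime = pp ∷ _ } =
  p , pp , subst (p ∣_) (sym n≡p*∏ps) (m∣m*n (product ps))

prime∣prime⇒≡ : ∀ {p q} → Prime p → Prime q → p ∣ q → p ≡ q
prime∣prime⇒≡ pp pq p∣q with prime⇒irreducible pq p∣q
... | inj₁ refl = ⊥-elim (<-irrefl refl (prime>1 pp))
... | inj₂ p≡q  = p≡q

prime∣^⇒∣ : ∀ {p q} k → Prime p → p ∣ q ^ k → p ∣ q
prime∣^⇒∣ zero    pp p∣1 = ⊥-elim (<-irrefl (sym (∣1⇒≡1 p∣1)) (prime>1 pp))
prime∣^⇒∣ {q = q} (suc k) pp p∣q^[1+k] with euclidsLemma q (q ^ k) pp p∣q^[1+k]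
... | inj₁ p∣q   = p∣q
... | inj₂ p∣q^k = prime∣^⇒∣ k pp p∣q^k

divisors-prime^[1+k]⊆ : ∀ {p} k → Prime p → divisors (p ^ suc k) ⊆ 1 ∷ map (p *_) (divisors (p ^ k))
divisors-prime^[1+k]⊆ {p} k pp {d} d∈ with ∈-divisors⁻ (p ^ suc k) d∈ | m≤n⇒m<n∨m≡n (∈-divisors⇒0< (p ^ suc k) d∈)
... | _ | inj₂ refl = here refl
... | d∣p^[1+k] | inj₁ d>1 with ∃prime∣ d>1
... | q , pq , q∣d with prime∣prime⇒≡ pq pp (prime∣^⇒∣ (suc k) pq (∣-trans q∣d d∣p^[1+k]))
... | refl with q∣d
... | divides e refl = there (subst (_∈ map (q *_) (divisors (q ^ k))) (*-comm q e) (∈-map⁺ (q *_) e∈))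
  where
  instance _ = prime⇒nonZero pp
  e∈ : e ∈ divisors (q ^ k)
  e∈ = ∈-divisors⁺ (m^n>0 q k) (*-cancelˡ-∣ q (subst (_∣ q * q ^ k) (*-comm e q) d∣p^[1+k]))

σ[p^[1+k]]≤1+p*σ[p^k] : ∀ {p} k → Prime p → σ (p ^ suc k) ≤ 1 + p * σ (p ^ k)
σ[p^[1+k]]≤1+p*σ[p^k] {p} k pp = begin
  σ (p ^ suc k)                            ≤⟨ sum-mono-⊆ _ (divisors-unique (p ^ suc k)) (divisors-prime^[1+k]⊆ k pp) ⟩
  1 + sum (map (p *_) (divisors (p ^ k)))  ≡⟨ cong (1 +_) (sum-map-*ˡ p (divisors (p ^ k))) ⟩
  1 + p * σ (p ^ k)                        ∎
  where open ≤-Reasoning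

σ[p^k]*[p-1]<p^[1+k] : ∀ {p} k → Prime p → σ (p ^ k) * pred p < p ^ suc k
σ[p^k]*[p-1]<p^[1+k] {p@(suc r)} zero    pp = ≤-reflexive (cong suc (trans (+-identityʳ r) (sym (*-identityʳ r))))
σ[p^k]*[p-1]<p^[1+k] {p@(suc r)} (suc k) pp = begin-strict
  σ (p ^ suc k) * r          ≤⟨ *-monoˡ-≤ r (σ[p^[1+k]]≤1+p*σ[p^k] k pp) ⟩
  (1 + p * σ (p ^ k)) * r    <⟨ ≤-reflexive (lemma r (σ (p ^ k))) ⟩
  p * suc (σ (p ^ k) * r)    ≤⟨ *-monoʳ-≤ p (σ[p^k]*[p-1]<p^[1+k] k pp) ⟩
  p * p ^ suc k              ∎
  where
  open ≤-Reasoning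
  lemma : ∀ r s → suc ((1 + suc r * s) * r) ≡ suc r * suc (s * r)
  lemma = solve 2 (λ r s → con 1 :+ (con 1 :+ (con 1 :+ r) :* s) :* r := (con 1 :+ r) :* (con 1 :+ s :* r)) refl

∏pred : List ℕ → ℕ
∏pred ps = product (map pred ps)

split-prime-power : ∀ {p u} → 1 < p → 0 < u → p ∣ u → ∃₂ λ k w → u ≡ p ^ suc k * w × p ∤ w
split-prime-power {p} {u} p>1 = go (<-wellFounded u)
  where
  go : ∀ {u} → Acc _<_ u → 0 < u → p ∣ u → ∃₂ λ k w → u ≡ p ^ suc k * w × p ∤ w
  go (acc smaller) u>0 (divides w refl) with p ∣? w
  ... | no p∤w = 0 , w , trans (*-comm w p) (cong (_* w) (sym (*-identityʳ p))) , p∤w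
  ... | yes p∣w with go (smaller (m<m*n w p {{w≢0}} p>1)) (>-nonZero⁻¹ w {{w≢0}}) p∣w
    where
    w≢0 : NonZero w
    w≢0 = m*n≢0⇒m≢0 w {{>-nonZero u>0}}
  ... | k , v , refl , p∤v = suc k , v , rearrange (p ^ suc k) v p , p∤v
    where
    rearrange : ∀ a v p → a * v * p ≡ p * a * v
    rearrange = solve 3 (λ a v p → a :* v :* p := p :* a :* v) refl

record PrimeSupport (u : ℕ) : Set where
  field
    primes         : List ℕ
    primes-unique  : Unique primes
    primes-prime   : All Prime primes
    primes-∣       : All (_∣ u) primes
    abundancy-≤    : σ u * ∏pred primes ≤ u * product primes

σ[p^[1+k]*w]-bound : ∀ {p} k w {Q P} → Prime p → 0 < w → σ w * Q ≤ w * P →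
                     σ (p ^ suc k * w) * (pred p * Q) ≤ p ^ suc k * w * (p * P)
σ[p^[1+k]*w]-bound {p} k w {Q} {P} pp w>0 σw*Q≤w*P = begin
  σ (q * w) * (pred p * Q)        ≤⟨ *-monoˡ-≤ (pred p * Q) (σ[m*n]≤σ[m]*σ[n] q w (m^n>0 p (suc k)) w>0) ⟩
  σ q * σ w * (pred p * Q)        ≡⟨ interchange (σ q) (σ w) (pred p) Q ⟩
  (σ q * pred p) * (σ w * Q)      ≤⟨ *-mono-≤ (<⇒≤ (σ[p^k]*[p-1]<p^[1+k] (suc k) pp)) σw*Q≤w*P ⟩
  (p * q) * (w * P)               ≡⟨ regroup p q w P ⟩
  q * w * (p * P)                 ∎
  where
  instance _ = prime⇒nonZero pp
  q = p ^ suc k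
  open ≤-Reasoning
  interchange : ∀ a b c d → a * b * (c * d) ≡ (a * c) * (b * d)
  interchange = solve 4 (λ a b c d → a :* b :* (c :* d) := (a :* c) :* (b :* d)) refl
  regroup : ∀ a b c d → (a * b) * (c * d) ≡ b * c * (a * d)
  regroup = solve 4 (λ a b c d → (a :* b) :* (c :* d) := b :* c :* (a :* d)) refl

primeSupport : ∀ {u} → 0 < u → PrimeSupport u
primeSupport {u} = go (<-wellFounded u)
  where
  open PrimeSupport
  go : ∀ {u} → Acc _<_ u → 0 < u → PrimeSupport u
  go {u} (acc smaller) u>0 with m≤n⇒m<n∨m≡n u>0
  ... | inj₂ refl = record
    { primes = [] ; primes-unique = [] ; primes-prime = [] ; primes-∣ = [] ; abundancy-≤ = ≤-refl }
  ... | inj₁ u>1 with ∃prime∣ u>1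
  ... | p , pp , p∣u with split-prime-power (prime>1 pp) u>0 p∣u
  ... | k , w , refl , p∤w = record
    { primes        = p ∷ primes rest
    ; primes-unique = All.map (λ q∣w p≡q → p∤w (subst (_∣ w) (sym p≡q) q∣w)) (primes-∣ rest) ∷ primes-unique rest
    ; primes-prime  = pp ∷ primes-prime rest
    ; primes-∣      = p∣u ∷ All.map (λ q∣w → ∣-trans q∣w (n∣m*n (p ^ suc k))) (primes-∣ rest)
    ; abundancy-≤   = σ[p^[1+k]*w]-bound k w pp w>0 (abundancy-≤ rest)
    }
    where
    q = p ^ suc k
    w≢0 : NonZero w
    w≢0 = m*n≢0⇒n≢0 q {{>-nonZero u>0}}
    w>0 : 0 < w
    w>0 = >-nonZero⁻¹ w {{w≢0}}
    w<q*w : w < q * w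
    w<q*w = subst (w <_) (*-comm w q) (m<m*n w q {{w≢0}} (^-monoʳ-< p (prime>1 pp) {0} {suc k} z<s))
    rest : PrimeSupport w
    rest = go (smaller w<q*w) w>0

m∣n! : ∀ {m n} → 0 < m → m ≤ n → m ∣ n !
m∣n! {suc m} _ m<n = ∣-trans (m∣m*n (m !)) (m≤n⇒m!∣n! m<n)

prime∤n! : ∀ {p} n → Prime p → n < p → p ∤ n !
prime∤n! zero    pp _   p∣1 = <-irrefl (sym (∣1⇒≡1 p∣1)) (prime>1 pp)
prime∤n! (suc n) pp n<p p∣[1+n]! with euclidsLemma (suc n) (n !) pp p∣[1+n]!
... | inj₁ p∣1+n = <-irrefl refl (<-≤-trans n<p (∣⇒≤ p∣1+n))
... | inj₂ p∣n!  = prime∤n! n pp (<-trans (n<1+n n) n<p) p∣n!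

nCk≤2^n : ∀ n k → n C k ≤ 2 ^ n
nCk≤2^n zero    zero    = ≤-refl
nCk≤2^n zero    (suc k) = ≤-trans (≤-reflexive (k>n⇒nCk≡0 {0} {suc k} z<s)) z≤n
nCk≤2^n (suc n) zero    = m^n>0 2 (suc n)
nCk≤2^n (suc n) (suc k) = begin
  suc n C suc k        ≡⟨ nCk+nC[k+1]≡[n+1]C[k+1] n k ⟨
  n C k + n C suc k    ≤⟨ +-mono-≤ (nCk≤2^n n k) (nCk≤2^n n (suc k)) ⟩
  2 ^ n + 2 ^ n        ≡⟨ cong (2 ^ n +_) (+-identityʳ (2 ^ n)) ⟨
  2 ^ suc n            ∎
  where open ≤-Reasoning

[2n]Cn*[n!*n!]≡[2n]! : ∀ n → ((2 * n) C n) * (n ! * n !) ≡ (2 * n) !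
[2n]Cn*[n!*n!]≡[2n]! n = subst (λ m → ((2 * n) C n) * (n ! * m !) ≡ (2 * n) !) 2n∸n≡n
  (trans (cong (_* (n ! * (2 * n ∸ n) !)) (nCk≡n!/k![n-k]! n≤2n))
         (m/n*n≡m {{n !* (2 * n ∸ n) !≢0}} (k![n∸k]!∣n! n≤2n)))
  where
  n≤2n : n ≤ 2 * n
  n≤2n = m≤m+n n (n + 0)
  2n∸n≡n : 2 * n ∸ n ≡ n
  2n∸n≡n = trans (cong (λ m → n + m ∸ n) (+-identityʳ n)) (m+n∸m≡n n n)

prime∣[2n]Cn : ∀ {p} n → Prime p → n < p → p ≤ 2 * n → p ∣ (2 * n) C n
prime∣[2n]Cn {p} n pp n<p p≤2n
  with euclidsLemma ((2 * n) C n) (n ! * n !) pp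
         (subst (p ∣_) (sym ([2n]Cn*[n!*n!]≡[2n]! n)) (m∣n! (<-trans z<s (prime>1 pp)) p≤2n))
... | inj₁ p∣C = p∣C
... | inj₂ p∣n!*n! with euclidsLemma (n !) (n !) pp p∣n!*n!
... | inj₁ p∣n! = ⊥-elim (prime∤n! n pp n<p p∣n!)
... | inj₂ p∣n! = ⊥-elim (prime∤n! n pp n<p p∣n!)

prime∤∏primes : ∀ {p} qs → Prime p → All Prime qs → All (p ≢_) qs → p ∤ product qs
prime∤∏primes []       pp []         []          p∣1 = <-irrefl (sym (∣1⇒≡1 p∣1)) (prime>1 pp)
prime∤∏primes (q ∷ qs) pp (pq ∷ pqs) (p≢q ∷ p≢qs) p∣q*∏qs with euclidsLemma q (product qs) pp p∣q*∏qs
... | inj₁ p∣q   = p≢q (prime∣prime⇒≡ pp pq p∣q)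
... | inj₂ p∣∏qs = prime∤∏primes qs pp pqs p≢qs p∣∏qs

prime∤⇒coprime : ∀ {p m} → Prime p → p ∤ m → Coprime p m
prime∤⇒coprime pp p∤m (d∣p , d∣m) with prime⇒irreducible pp d∣p
... | inj₁ d≡1 = d≡1
... | inj₂ refl = ⊥-elim (p∤m d∣m)

∏distinctPrimes∣ : ∀ {n} ps → Unique ps → All Prime ps → All (_∣ n) ps → product ps ∣ n
∏distinctPrimes∣ []       _                _          _             = 1∣ _
∏distinctPrimes∣ (p ∷ ps) (p∉ps ∷ ps-uniq) (pp ∷ pps) (p∣n ∷ ps∣n)
  with ∏distinctPrimes∣ ps ps-uniq pps ps∣n
... | divides m n≡m*∏ps = subst (p * product ps ∣_) (sym n≡m*∏ps) (*-monoˡ-∣ (product ps) p∣m)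
  where
  p∣m : p ∣ m
  p∣m = coprime-divisor (prime∤⇒coprime pp (prime∤∏primes ps pp pps p∉ps))
          (subst (p ∣_) (trans n≡m*∏ps (*-comm m (product ps))) p∣n)

n^length≤product : ∀ {n} ms → All (n ≤_) ms → n ^ length ms ≤ product ms
n^length≤product []       []           = ≤-refl
n^length≤product (m ∷ ms) (n≤m ∷ n≤ms) = *-mono-≤ n≤m (n^length≤product ms n≤ms)

chebyshev-bound : ∀ n ps → Unique ps → All Prime ps → All (λ p → n < p × p ≤ 2 * n) ps →
                        n ^ length ps ≤ 2 ^ (2 * n)
chebyshev-bound n ps ps-uniq pps ps∈⟨n,2n] = begin
  n ^ length ps   ≤⟨ n^length≤product ps (All.map (<⇒≤ ∘ proj₁) ps∈⟨n,2n]) ⟩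
  product ps      ≤⟨ ∣⇒≤ {{C≢0}} (∏distinctPrimes∣ ps ps-uniq pps ps∣C) ⟩
  (2 * n) C n     ≤⟨ nCk≤2^n (2 * n) n ⟩
  2 ^ (2 * n)     ∎
  where
  open ≤-Reasoning
  ps∣C : All (_∣ (2 * n) C n) ps
  ps∣C = All.zipWith (λ (pp , n<p , p≤2n) → prime∣[2n]Cn n pp n<p p≤2n) (pps , ps∈⟨n,2n])
  C≢0 : NonZero ((2 * n) C n)
  C≢0 = m*n≢0⇒m≢0 ((2 * n) C n) {{subst NonZero (sym ([2n]Cn*[n!*n!]≡[2n]! n)) ((2 * n) !≢0)}}

2^m≤2^n⇒m≤n : ∀ {m n} → 2 ^ m ≤ 2 ^ n → m ≤ n
2^m≤2^n⇒m≤n {m} {n} 2^m≤2^n with m ≤? n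
... | yes m≤n = m≤n
... | no  m≰n = ⊥-elim (<⇒≱ (^-monoʳ-< 2 (s≤s (s≤s z≤n)) (≰⇒> m≰n)) 2^m≤2^n)

chebyshev-dyadic-bound : ∀ k ps → Unique ps → All Prime ps →
                                   All (λ p → 2 ^ k < p × p ≤ 2 ^ suc k) ps → k * length ps ≤ 2 ^ suc k
chebyshev-dyadic-bound k ps ps-uniq pps ps∈ = 2^m≤2^n⇒m≤n (begin
  2 ^ (k * length ps)        ≡⟨ ^-*-assoc 2 k (length ps) ⟨
  (2 ^ k) ^ length ps        ≤⟨ chebyshev-bound (2 ^ k) ps ps-uniq pps ps∈ ⟩
  2 ^ (2 ^ suc k)            ∎)
  where open ≤-Reasoning

2*⌊n/2⌋≤n : ∀ n → 2 * ⌊ n /2⌋ ≤ n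
2*⌊n/2⌋≤n n = begin
  ⌊ n /2⌋ + (⌊ n /2⌋ + 0)   ≡⟨ cong (⌊ n /2⌋ +_) (+-identityʳ ⌊ n /2⌋) ⟩
  ⌊ n /2⌋ + ⌊ n /2⌋         ≤⟨ +-monoʳ-≤ ⌊ n /2⌋ (⌊n/2⌋≤⌈n/2⌉ n) ⟩
  ⌊ n /2⌋ + ⌈ n /2⌉         ≡⟨ ⌊n/2⌋+⌈n/2⌉≡n n ⟩
  n                         ∎
  where open ≤-Reasoning

2^⌊log₂n⌋≤n : ∀ {n} → 0 < n → 2 ^ ⌊log₂ n ⌋ ≤ n
2^⌊log₂n⌋≤n {n} = go (<-wellFounded n)
  where
  go : ∀ {n} → Acc _<_ n → 0 < n → 2 ^ ⌊log₂ n ⌋ ≤ n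
  go {1}           _             _ = ≤-refl
  go {suc (suc m)} (acc smaller) _ = begin
    2 ^ ⌊log₂ (2 + m) ⌋         ≡⟨ cong (λ k → 2 ^ suc k) (⌊log2⌋-acc-irrelevant (suc ⌊ m /2⌋)) ⟩
    2 * 2 ^ ⌊log₂ half ⌋     ≤⟨ *-monoʳ-≤ 2 (go (smaller (⌊n/2⌋<n (suc m))) z<s) ⟩
    2 * half                 ≡⟨ *-suc 2 ⌊ m /2⌋ ⟩
    2 + 2 * ⌊ m /2⌋             ≤⟨ +-monoʳ-≤ 2 (2*⌊n/2⌋≤n m) ⟩
    2 + m                       ∎
    where
    open ≤-Reasoning
    half = suc ⌊ m /2⌋

2^k≤n⇒k≤⌊log₂n⌋ : ∀ {k n} → 2 ^ k ≤ n → k ≤ ⌊log₂ n ⌋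
2^k≤n⇒k≤⌊log₂n⌋ {k} 2^k≤n = subst (_≤ _) (⌊log₂[2^n]⌋≡n k) (⌊log₂⌋-mono-≤ 2^k≤n)

n<2^[1+⌊log₂n⌋] : ∀ n → n < 2 ^ suc ⌊log₂ n ⌋
n<2^[1+⌊log₂n⌋] n with n <? 2 ^ suc ⌊log₂ n ⌋
... | yes n<2^[1+k] = n<2^[1+k]
... | no  n≮2^[1+k] = ⊥-elim (1+n≰n (2^k≤n⇒k≤⌊log₂n⌋ (≮⇒≥ n≮2^[1+k])))

∑< : ℕ → (ℕ → ℕ) → ℕ
∑< zero    f = 0
∑< (suc n) f = ∑< n f + f n

∑<-cong : ∀ n {f g} → (∀ i → f i ≡ g i) → ∑< n f ≡ ∑< n g
∑<-cong zero    f≗g = refl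
∑<-cong (suc n) f≗g = cong₂ _+_ (∑<-cong n f≗g) (f≗g n)

∑<-distrib-+ : ∀ n f g → ∑< n (λ i → f i + g i) ≡ ∑< n f + ∑< n g
∑<-distrib-+ zero    f g = refl
∑<-distrib-+ (suc n) f g = trans (cong (_+ (f n + g n)) (∑<-distrib-+ n f g)) (shuffle (∑< n f) (∑< n g) (f n) (g n))
  where
  shuffle : ∀ a b c d → a + b + (c + d) ≡ a + c + (b + d)
  shuffle = solve 4 (λ a b c d → a :+ b :+ (c :+ d) := a :+ c :+ (b :+ d)) refl

f[i]≤∑< : ∀ n f {i} → i < n → f i ≤ ∑< n f
f[i]≤∑< (suc n) f i<1+n with m≤n⇒m<n∨m≡n (≤-pred i<1+n)
... | inj₁ i<n  = ≤-trans (f[i]≤∑< n f i<n) (m≤m+n _ _)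
... | inj₂ refl = m≤n+m _ _

∑<-*-bound : ∀ n f {t c} → (∀ {i} → i < n → f i * t ≤ c) → ∑< n f * t ≤ n * c
∑<-*-bound zero    f _     = z≤n
∑<-*-bound (suc n) f {t} {c} f*t≤c = begin
  (∑< n f + f n) * t        ≡⟨ *-distribʳ-+ t (∑< n f) (f n) ⟩
  ∑< n f * t + f n * t      ≤⟨ +-mono-≤ (∑<-*-bound n f (λ i<n → f*t≤c (m<n⇒m<1+n i<n))) (f*t≤c (n<1+n n)) ⟩
  n * c + c                 ≡⟨ +-comm (n * c) c ⟩
  suc n * c                 ∎
  where open ≤-Reasoning

δ : ℕ → ℕ → ℕ
δ m n = if m ≡ᵇ n then 1 else 0

δ-refl : ∀ n → δ n n ≡ 1
δ-refl n with n ≡ᵇ n | ≡⇒≡ᵇ n n refl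
... | true | _ = refl

level : ℕ → ℕ
level p = ⌊log₂ pred p ⌋

2^level≤pred : ∀ {p} → Prime p → 2 ^ level p ≤ pred p
2^level≤pred pp with prime>1 pp
... | s≤s (s≤s _) = 2^⌊log₂n⌋≤n z<s

level-bounds : ∀ {p} → Prime p → 2 ^ level p < p × p ≤ 2 ^ suc (level p)
level-bounds pp with prime>1 pp
... | s≤s (s≤s {n = r} _) = s≤s (2^level≤pred pp) , n<2^[1+⌊log₂n⌋] (suc r)

2^Σlevel≤∏pred : ∀ ps → All Prime ps → 2 ^ sum (map level ps) ≤ ∏pred ps
2^Σlevel≤∏pred []       []         = ≤-refl
2^Σlevel≤∏pred (p ∷ ps) (pp ∷ pps) = begin
  2 ^ (level p + sum (map level ps))       ≡⟨ ^-distribˡ-+-* 2 (level p) _ ⟩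
  2 ^ level p * 2 ^ sum (map level ps)     ≤⟨ *-mono-≤ (2^level≤pred pp) (2^Σlevel≤∏pred ps pps) ⟩
  pred p * ∏pred ps                        ∎
  where
  open ≤-Reasoning

-- With W = 2^(t+J) every prime satisfies W ≤ weight p · (p − 1). A prime at level t + i with
-- i < J has weight 2^(J−i), and Chebyshev bounds the primes at each such level; a prime at
-- level ≥ t + J has weight 1, and there are few of them because their levels sum to at most
-- log₂ of their product.
module DyadicWeights (t J : ℕ) where

  weight : ℕ → ℕ
  weight p = 2 ^ (t + J ∸ level p)

  lowWeight : ℕ → ℕ
  lowWeight p = ∑< J (λ i → 2 ^ (J ∸ i) * δ (level p) (t + i))

  count : ℕ → List ℕ → ℕ
  count i ps = length (filter (λ p → level p ≟ t + i) ps)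

  lowMass : List ℕ → ℕ
  lowMass ps = ∑< J (λ i → 2 ^ (J ∸ i) * count i ps)

  lowMass-∷ : ∀ p ps → lowMass (p ∷ ps) ≡ lowWeight p + lowMass ps
  lowMass-∷ p ps = trans (∑<-cong J (λ i → trans (cong (2 ^ (J ∸ i) *_) (count-∷ i)) (*-distribˡ-+ (2 ^ (J ∸ i)) _ _)))
                         (∑<-distrib-+ J _ _)
    where
    count-∷ : ∀ i → count i (p ∷ ps) ≡ δ (level p) (t + i) + count i ps
    count-∷ i with level p ≡ᵇ t + i
    ... | true  = refl
    ... | false = refl

  weight*[p-1]-≥ : ∀ {p} → Prime p → 2 ^ (t + J) ≤ weight p * pred p
  weight*[p-1]-≥ {p} pp = begin
    2 ^ (t + J)                              ≤⟨ ^-monoʳ-≤ 2 (m≤m∸n+n (t + J) (level p)) ⟩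
    2 ^ (t + J ∸ level p + level p)          ≡⟨ ^-distribˡ-+-* 2 (t + J ∸ level p) (level p) ⟩
    weight p * 2 ^ level p                   ≤⟨ *-monoʳ-≤ (weight p) (2^level≤pred pp) ⟩
    weight p * pred p                        ∎
    where
    open ≤-Reasoning
    m≤m∸n+n : ∀ m n → m ≤ m ∸ n + n
    m≤m∸n+n m n with n ≤? m
    ... | yes n≤m = ≤-reflexive (sym (m∸n+n≡m n≤m))
    ... | no  n≰m = ≤-trans (<⇒≤ (≰⇒> n≰m)) (m≤n+m n (m ∸ n))

  [t+J]*weight≤ : ∀ p → t ≤ level p → (t + J) * weight p ≤ (t + J) * lowWeight p + level p
  [t+J]*weight≤ p t≤level with t + J ≤? level p
  ... | yes t+J≤level = begin
    (t + J) * 2 ^ (t + J ∸ level p)     ≡⟨ cong (λ k → (t + J) * 2 ^ k) (m≤n⇒m∸n≡0 t+J≤level) ⟩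
    (t + J) * 1                         ≡⟨ *-identityʳ (t + J) ⟩
    t + J                               ≤⟨ t+J≤level ⟩
    level p                             ≤⟨ m≤n+m (level p) _ ⟩
    (t + J) * lowWeight p + level p     ∎
    where open ≤-Reasoning
  ... | no  t+J≰level = ≤-trans (*-monoʳ-≤ (t + J) weight≤lowWeight) (m≤m+n _ (level p))
    where
    i = level p ∸ t
    level≡t+i : level p ≡ t + i
    level≡t+i = sym (m+[n∸m]≡n t≤level)
    i<J : i < J
    i<J = +-cancelˡ-< t i J (subst (_< t + J) level≡t+i (≰⇒> t+J≰level))
    weight≤lowWeight : weight p ≤ lowWeight p
    weight≤lowWeight = begin
      2 ^ (t + J ∸ level p)                     ≡⟨ cong (λ k → 2 ^ (t + J ∸ k)) level≡t+i ⟩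
      2 ^ (t + J ∸ (t + i))                     ≡⟨ cong (2 ^_) ([m+n]∸[m+o]≡n∸o t J i) ⟩
      2 ^ (J ∸ i)                               ≡⟨ *-identityʳ (2 ^ (J ∸ i)) ⟨
      2 ^ (J ∸ i) * 1                           ≡⟨ cong (2 ^ (J ∸ i) *_) (trans (cong (λ k → δ k (t + i)) level≡t+i) (δ-refl (t + i))) ⟨
      2 ^ (J ∸ i) * δ (level p) (t + i)         ≤⟨ f[i]≤∑< J (λ i → 2 ^ (J ∸ i) * δ (level p) (t + i)) i<J ⟩
      lowWeight p                               ∎
      where open ≤-Reasoning

  [t+J]*Σweight≤ : ∀ ps → All (λ p → t ≤ level p) ps →
                   (t + J) * sum (map weight ps) ≤ (t + J) * lowMass ps + sum (map level ps)
  [t+J]*Σweight≤ []       []               = ≤-trans (≤-reflexive (*-zeroʳ (t + J))) z≤n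
  [t+J]*Σweight≤ (p ∷ ps) (t≤level ∷ t≤levels) = begin
    a * (weight p + sum (map weight ps))                          ≡⟨ *-distribˡ-+ a (weight p) _ ⟩
    a * weight p + a * sum (map weight ps)                        ≤⟨ +-mono-≤ ([t+J]*weight≤ p t≤level) ([t+J]*Σweight≤ ps t≤levels) ⟩
    (a * lowWeight p + level p) + (a * lowMass ps + K)            ≡⟨ shuffle a (lowWeight p) (level p) (lowMass ps) K ⟩
    a * (lowWeight p + lowMass ps) + (level p + K)                ≡⟨ cong (λ m → a * m + (level p + K)) (lowMass-∷ p ps) ⟨
    a * lowMass (p ∷ ps) + (level p + K)                          ∎
    where
    open ≤-Reasoning
    a = t + J
    K = sum (map level ps)
    shuffle : ∀ a b c d e → (a * b + c) + (a * d + e) ≡ a * (b + d) + (c + e)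
    shuffle = solve 5 (λ a b c d e → (a :* b :+ c) :+ (a :* d :+ e) := a :* (b :+ d) :+ (c :+ e)) refl

  count*[t+i]≤ : ∀ i ps → Unique ps → All Prime ps → (t + i) * count i ps ≤ 2 ^ suc (t + i)
  count*[t+i]≤ i ps ps-uniq pps =
    chebyshev-dyadic-bound (t + i) atLevel (Unique.filter⁺ _ ps-uniq) (All.filter⁺ _ pps)
      (All.zipWith (λ {p} (pp , level≡) → subst (λ k → 2 ^ k < p × p ≤ 2 ^ suc k) level≡ (level-bounds pp))
                   (All.filter⁺ _ pps , All.all-filter _ ps))
    where
    atLevel = filter (λ p → level p ≟ t + i) ps

  lowMass*t≤ : ∀ ps → Unique ps → All Prime ps → lowMass ps * t ≤ J * 2 ^ suc (t + J)
  lowMass*t≤ ps ps-uniq pps = ∑<-*-bound J _ term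
    where
    term : ∀ {i} → i < J → 2 ^ (J ∸ i) * count i ps * t ≤ 2 ^ suc (t + J)
    term {i} i<J = begin
      2 ^ (J ∸ i) * c * t                 ≡⟨ *-assoc (2 ^ (J ∸ i)) c t ⟩
      2 ^ (J ∸ i) * (c * t)               ≤⟨ *-monoʳ-≤ (2 ^ (J ∸ i)) c*t≤ ⟩
      2 ^ (J ∸ i) * 2 ^ suc (t + i)       ≡⟨ ^-distribˡ-+-* 2 (J ∸ i) (suc (t + i)) ⟨
      2 ^ (J ∸ i + suc (t + i))           ≡⟨ cong (2 ^_) exponent ⟩
      2 ^ suc (t + J)                     ∎
      where
      open ≤-Reasoning
      c = count i ps
      c*t≤ : c * t ≤ 2 ^ suc (t + i)
      c*t≤ = ≤-trans (*-monoʳ-≤ c (m≤m+n t i)) (≤-trans (≤-reflexive (*-comm c (t + i))) (count*[t+i]≤ i ps ps-uniq pps))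
      exponent : J ∸ i + suc (t + i) ≡ suc (t + J)
      exponent = trans (+-suc (J ∸ i) (t + i)) (cong suc (trans (+-comm (J ∸ i) (t + i))
                   (trans (+-assoc t i (J ∸ i)) (cong (t +_) (m+[n∸m]≡n (<⇒≤ i<J))))))

[A∸w]*[1+r]≤A*r : ∀ A w r → A ≤ w * r → (A ∸ w) * suc r ≤ A * r
[A∸w]*[1+r]≤A*r A w r A≤w*r with w ≤? A
... | no  w≰A = ≤-trans (≤-reflexive (cong (_* suc r) (m≤n⇒m∸n≡0 (<⇒≤ (≰⇒> w≰A))))) z≤n
... | yes w≤A = begin
  (A ∸ w) * suc r             ≡⟨ *-suc (A ∸ w) r ⟩
  (A ∸ w) + (A ∸ w) * r       ≤⟨ +-monoˡ-≤ ((A ∸ w) * r) (≤-trans (m∸n≤m A w) A≤w*r) ⟩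
  w * r + (A ∸ w) * r         ≡⟨ *-distribʳ-+ r w (A ∸ w) ⟨
  (w + (A ∸ w)) * r           ≡⟨ cong (_* r) (m+[n∸m]≡n w≤A) ⟩
  A * r                       ∎
  where open ≤-Reasoning

weighted-∏-bound : ∀ (ω : ℕ → ℕ) W ps → All (λ p → W ≤ ω p * pred p) ps →
                   (W ∸ sum (map ω ps)) * product ps ≤ W * ∏pred ps
weighted-∏-bound ω W []           []       = ≤-refl
weighted-∏-bound ω W (zero ∷ ps)  (_ ∷ _)  = ≤-trans (≤-reflexive (*-zeroʳ (W ∸ sum (map ω (0 ∷ ps))))) z≤n
weighted-∏-bound ω W (suc r ∷ ps) (W≤ω[p]*r ∷ W≤ω*pred) = begin
  (W ∸ (w + s)) * (suc r * product ps)    ≡⟨ cong (_* (suc r * product ps)) W∸[w+s]≡A∸w ⟩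
  (A ∸ w) * (suc r * product ps)          ≡⟨ *-assoc (A ∸ w) (suc r) (product ps) ⟨
  (A ∸ w) * suc r * product ps            ≤⟨ *-monoˡ-≤ (product ps) ([A∸w]*[1+r]≤A*r A w r (≤-trans (m∸n≤m W s) W≤ω[p]*r)) ⟩
  A * r * product ps                      ≡⟨ swap A r (product ps) ⟩
  A * product ps * r                      ≤⟨ *-monoˡ-≤ r (weighted-∏-bound ω W ps W≤ω*pred) ⟩
  W * ∏pred ps * r                        ≡⟨ rotate W (∏pred ps) r ⟩
  W * (r * ∏pred ps)                      ∎
  where
  open ≤-Reasoning
  w = ω (suc r)
  s = sum (map ω ps)
  A = W ∸ s
  W∸[w+s]≡A∸w : W ∸ (w + s) ≡ A ∸ w
  W∸[w+s]≡A∸w = trans (cong (W ∸_) (+-comm w s)) (sym (∸-+-assoc W s w))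
  swap : ∀ a b c → a * b * c ≡ a * c * b
  swap = solve 3 (λ a b c → a :* b :* c := a :* c :* b) refl
  rotate : ∀ a b c → a * b * c ≡ a * (c * b)
  rotate = solve 3 (λ a b c → a :* b :* c := a :* (c :* b)) refl

D*P≤[1+D]*Q : ∀ {D W S P Q} → 0 < W → suc D * S ≤ W → (W ∸ S) * P ≤ W * Q → D * P ≤ suc D * Q
D*P≤[1+D]*Q {D} {W} {S} {P} {Q} W>0 [1+D]*S≤W [W∸S]*P≤W*Q = *-cancelˡ-≤ W {{>-nonZero W>0}} (begin
  W * (D * P)                 ≡⟨ trans (sym (*-assoc W D P)) (cong (_* P) (*-comm W D)) ⟩
  D * W * P                   ≤⟨ *-monoˡ-≤ P D*W≤[1+D]*[W∸S] ⟩
  suc D * (W ∸ S) * P         ≡⟨ *-assoc (suc D) (W ∸ S) P ⟩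
  suc D * ((W ∸ S) * P)       ≤⟨ *-monoʳ-≤ (suc D) [W∸S]*P≤W*Q ⟩
  suc D * (W * Q)             ≡⟨ trans (sym (*-assoc (suc D) W Q)) (trans (cong (_* Q) (*-comm (suc D) W)) (*-assoc W (suc D) Q)) ⟩
  W * (suc D * Q)             ∎)
  where
  open ≤-Reasoning
  D*W≤[1+D]*[W∸S] : D * W ≤ suc D * (W ∸ S)
  D*W≤[1+D]*[W∸S] = begin
    D * W                     ≡⟨ m+n∸n≡m (D * W) W ⟨
    D * W + W ∸ W             ≡⟨ cong (_∸ W) (+-comm (D * W) W) ⟩
    suc D * W ∸ W             ≤⟨ ∸-monoʳ-≤ (suc D * W) [1+D]*S≤W ⟩
    suc D * W ∸ suc D * S     ≡⟨ *-distribˡ-∸ (suc D) W S ⟨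
    suc D * (W ∸ S)           ∎

d*S≤W : ∀ {d t J S F K L W} → 0 < t → 4 * J * d ≤ t → 2 * d * L ≤ W * t → K ≤ L →
        F * t ≤ J * (2 * W) → (t + J) * S ≤ (t + J) * F + K → d * S ≤ W
d*S≤W {d} {t} {J} {S} {F} {K} {L} {W} t>0 4Jd≤t 2dL≤Wt K≤L Ft≤2JW aS≤aF+K =
  *-cancelˡ-≤ (2 * t * a) {{>-nonZero 2ta>0}} (begin
  (2 * t * a) * (d * S)                      ≡⟨ e₁ t a d S ⟩
  (2 * d * t) * (a * S)                      ≤⟨ *-monoʳ-≤ (2 * d * t) aS≤aF+K ⟩
  (2 * d * t) * (a * F + K)                  ≡⟨ e₂ d t a F K ⟩
  (2 * d * a) * (F * t) + (2 * d * K) * t    ≤⟨ +-mono-≤ (*-monoʳ-≤ (2 * d * a) Ft≤2JW) (*-monoˡ-≤ t (*-monoʳ-≤ (2 * d) K≤L)) ⟩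
  (2 * d * a) * (J * (2 * W)) + (2 * d * L) * t ≤⟨ +-monoʳ-≤ ((2 * d * a) * (J * (2 * W))) (*-monoˡ-≤ t 2dL≤Wt) ⟩
  (2 * d * a) * (J * (2 * W)) + (W * t) * t  ≡⟨ e₃ d a J W t ⟩
  (4 * J * d) * (a * W) + (W * t) * t        ≤⟨ +-mono-≤ (*-monoˡ-≤ (a * W) 4Jd≤t) (*-monoʳ-≤ (W * t) (m≤m+n t J)) ⟩
  t * (a * W) + (W * t) * a                  ≡⟨ e₄ t a W ⟩
  (2 * t * a) * W                            ∎)
  where
  open ≤-Reasoning
  a = t + J
  2ta>0 : 0 < 2 * t * a
  2ta>0 = *-mono-< (*-mono-< (z<s {1}) t>0) (<-≤-trans t>0 (m≤m+n t J))
  e₁ : ∀ t a d S → (2 * t * a) * (d * S) ≡ (2 * d * t) * (a * S)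
  e₁ = solve 4 (λ t a d S → (con 2 :* t :* a) :* (d :* S) := (con 2 :* d :* t) :* (a :* S)) refl
  e₂ : ∀ d t a F K → (2 * d * t) * (a * F + K) ≡ (2 * d * a) * (F * t) + (2 * d * K) * t
  e₂ = solve 5 (λ d t a F K → (con 2 :* d :* t) :* (a :* F :+ K) := (con 2 :* d :* a) :* (F :* t) :+ (con 2 :* d :* K) :* t) refl
  e₃ : ∀ d a J W t → (2 * d * a) * (J * (2 * W)) + (W * t) * t ≡ (4 * J * d) * (a * W) + (W * t) * t
  e₃ = solve 5 (λ d a J W t → (con 2 :* d :* a) :* (J :* (con 2 :* W)) :+ (W :* t) :* t := (con 4 :* J :* d) :* (a :* W) :+ (W :* t) :* t) refl
  e₄ : ∀ t a W → t * (a * W) + (W * t) * a ≡ (2 * t * a) * W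
  e₄ = solve 3 (λ t a W → t :* (a :* W) :+ (W :* t) :* a := (con 2 :* t :* a) :* W) refl

∏pred≤product : ∀ ps → ∏pred ps ≤ product ps
∏pred≤product []       = ≤-refl
∏pred≤product (p ∷ ps) = *-mono-≤ (pred[n]≤n {p}) (∏pred≤product ps)

2^t<p⇒t≤level : ∀ {t p} → Prime p → 2 ^ t < p → t ≤ level p
2^t<p⇒t≤level {t} {p} pp 2^t<p with t ≤? level p
... | yes t≤level = t≤level
... | no  t≰level = ⊥-elim (<-irrefl refl (<-≤-trans 2^t<p (≤-trans (proj₂ (level-bounds pp)) (^-monoʳ-≤ 2 (≰⇒> t≰level)))))

large-primes-abundancy : ∀ D t J L ps → Unique ps → All Prime ps → All (2 ^ t <_) ps →
                         product ps ≤ 2 ^ L → 0 < t → 4 * J * suc D ≤ t → 2 * suc D * L ≤ 2 ^ (t + J) * t →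
                         D * product ps ≤ suc D * ∏pred ps
large-primes-abundancy D t J L ps ps-uniq pps ps>2^t ∏ps≤2^L t>0 4Jd≤t 2dL≤Wt =
  D*P≤[1+D]*Q {D} (m^n>0 2 (t + J))
    (d*S≤W t>0 4Jd≤t 2dL≤Wt Σlevel≤L (lowMass*t≤ ps ps-uniq pps)
           ([t+J]*Σweight≤ ps (All.zipWith (λ (pp , 2^t<p) → 2^t<p⇒t≤level pp 2^t<p) (pps , ps>2^t))))
    (weighted-∏-bound weight (2 ^ (t + J)) ps (All.map weight*[p-1]-≥ pps))
  where
  open DyadicWeights t J
  Σlevel≤L : sum (map level ps) ≤ L
  Σlevel≤L = 2^m≤2^n⇒m≤n (≤-trans (2^Σlevel≤∏pred ps pps) (≤-trans (∏pred≤product ps) ∏ps≤2^L))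

n<2^n : ∀ n → n < 2 ^ n
n<2^n zero    = z<s
n<2^n (suc n) = begin-strict
  suc n           <⟨ +-mono-≤ (m^n>0 2 n) (n<2^n n) ⟩
  2 ^ n + 2 ^ n   ≡⟨ cong (2 ^ n +_) (+-identityʳ (2 ^ n)) ⟨
  2 ^ suc n       ∎
  where open ≤-Reasoning

n!≤n^n : ∀ n → n ! ≤ n ^ n
n!≤n^n zero    = ≤-refl
n!≤n^n (suc n) = *-monoʳ-≤ (suc n) (≤-trans (n!≤n^n n) (^-monoˡ-≤ n (n≤1+n n)))

[1+a]*n!≤2^[1+a+k*n] : ∀ a n k → n ≤ 2 ^ k → suc a * n ! ≤ 2 ^ (suc a + k * n)
[1+a]*n!≤2^[1+a+k*n] a n k n≤2^k = begin
  suc a * n !               ≤⟨ *-mono-≤ (<⇒≤ (n<2^n (suc a))) (≤-trans (n!≤n^n n) (^-monoˡ-≤ n n≤2^k)) ⟩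
  2 ^ suc a * (2 ^ k) ^ n   ≡⟨ cong (2 ^ suc a *_) (^-*-assoc 2 k n) ⟩
  2 ^ suc a * 2 ^ (k * n)   ≡⟨ ^-distribˡ-+-* 2 (suc a) (k * n) ⟨
  2 ^ (suc a + k * n)       ∎
  where open ≤-Reasoning

threshold : ℕ → ℕ → ℕ
threshold D a = 72 * (suc D * suc D) + (a + 2)

threshold-conditions : ∀ D a t n → threshold D a ≤ t → n ≤ 2 ^ t * 4 →
                       0 < t × 4 * (18 * suc D) * suc D ≤ t ×
                       2 * suc D * (suc a + (t + 2) * n) ≤ 2 ^ (t + 18 * suc D) * t
threshold-conditions D a t n threshold≤t n≤2^t*4 = t>0 , 4Jd≤t , (begin
  2 * d * (suc a + (t + 2) * n)       ≤⟨ *-monoʳ-≤ (2 * d) (+-mono-≤ 1+a≤t*E (*-mono-≤ (+-monoʳ-≤ t 2≤t) n≤2^t*4)) ⟩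
  2 * d * (t * E + (t + t) * (E * 4)) ≡⟨ e₁ d t E ⟩
  (18 * d) * (t * E)                  ≤⟨ *-monoˡ-≤ (t * E) (<⇒≤ (n<2^n (18 * d))) ⟩
  2 ^ (18 * d) * (t * E)              ≡⟨ e₂ (2 ^ (18 * d)) t E ⟩
  (E * 2 ^ (18 * d)) * t              ≡⟨ cong (_* t) (^-distribˡ-+-* 2 t (18 * d)) ⟨
  2 ^ (t + 18 * d) * t                ∎)
  where
  open ≤-Reasoning
  d = suc D
  E = 2 ^ t
  2+a≤t : 2 + a ≤ t
  2+a≤t = ≤-trans (≤-reflexive (+-comm 2 a)) (≤-trans (m≤n+m (a + 2) (72 * (d * d))) threshold≤t)
  t>0 : 0 < t
  t>0 = ≤-trans (m≤m+n 1 (1 + a)) 2+a≤t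
  2≤t : 2 ≤ t
  2≤t = ≤-trans (m≤m+n 2 a) 2+a≤t
  1+a≤t*E : suc a ≤ t * E
  1+a≤t*E = ≤-trans (≤-trans (n≤1+n (suc a)) 2+a≤t) (m≤m*n t E {{m^n≢0 2 t}})
  4Jd≤t : 4 * (18 * d) * d ≤ t
  4Jd≤t = ≤-trans (≤-reflexive (e d)) (≤-trans (m≤m+n (72 * (d * d)) (a + 2)) threshold≤t)
    where
    e : ∀ d → 4 * (18 * d) * d ≡ 72 * (d * d)
    e = solve 1 (λ d → con 4 :* (con 18 :* d) :* d := con 72 :* (d :* d)) refl
  e₁ : ∀ d t E → 2 * d * (t * E + (t + t) * (E * 4)) ≡ (18 * d) * (t * E)
  e₁ = solve 3 (λ d t E → con 2 :* d :* (t :* E :+ (t :+ t) :* (E :* con 4)) := (con 18 :* d) :* (t :* E)) refl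
  e₂ : ∀ X t E → X * (t * E) ≡ (E * X) * t
  e₂ = solve 3 (λ X t E → X :* (t :* E) := (E :* X) :* t) refl

rough-abundancy : ∀ D a n T u → 0 < u → (∀ {p} → Prime p → p ∣ u → T < p) → u ≤ suc a * n ! →
                  2 ^ threshold D a ≤ T → n ≤ 2 * T → D * σ u ≤ suc D * u
rough-abundancy D a n T u u>0 T<prime-factors u≤[1+a]*n! 2^threshold≤T n≤2T =
  *-cancelʳ-≤ (D * σ u) (suc D * u) Q {{Q≢0}} (begin
    D * σ u * Q          ≡⟨ *-assoc D (σ u) Q ⟩
    D * (σ u * Q)        ≤⟨ *-monoʳ-≤ D (abundancy-≤ support) ⟩
    D * (u * P)          ≡⟨ *-comm-middle D u P ⟩
    u * (D * P)          ≤⟨ *-monoʳ-≤ u (large-primes-abundancy D t J L ps (primes-unique support) (primes-prime support)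
                                           ps>2^t P≤2^L t>0 4Jd≤t 2dL≤2^[t+J]*t) ⟩
    u * (suc D * Q)      ≡⟨ *-comm-middle u (suc D) Q ⟩
    suc D * (u * Q)      ≡⟨ *-assoc (suc D) u Q ⟨
    suc D * u * Q        ∎)
  where
  open ≤-Reasoning
  open PrimeSupport
  support = primeSupport u>0
  ps = primes support
  P = product ps
  Q = ∏pred ps
  Q≢0 : NonZero Q
  Q≢0 = >-nonZero (≤-trans (m^n>0 2 (sum (map level ps))) (2^Σlevel≤∏pred ps (primes-prime support)))
  d = suc D
  J = 18 * d
  t = ⌊log₂ T ⌋
  L = suc a + (t + 2) * n
  *-comm-middle : ∀ a b c → a * (b * c) ≡ b * (a * c)
  *-comm-middle = solve 3 (λ a b c → a :* (b :* c) := b :* (a :* c)) refl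
  n≤2^t*4 : n ≤ 2 ^ t * 4
  n≤2^t*4 = ≤-trans n≤2T (≤-trans (*-monoʳ-≤ 2 (<⇒≤ (n<2^[1+⌊log₂n⌋] T))) (≤-reflexive (e (2 ^ t))))
    where
    e : ∀ E → 2 * (2 * E) ≡ E * 4
    e = solve 1 (λ E → con 2 :* (con 2 :* E) := E :* con 4) refl
  conditions = threshold-conditions D a t n (2^k≤n⇒k≤⌊log₂n⌋ 2^threshold≤T) n≤2^t*4
  t>0 = proj₁ conditions
  4Jd≤t = proj₁ (proj₂ conditions)
  2dL≤2^[t+J]*t = proj₂ (proj₂ conditions)
  ps>2^t : All (2 ^ t <_) ps
  ps>2^t = All.zipWith (λ (pp , p∣u) → ≤-<-trans 2^t≤T (T<prime-factors pp p∣u)) (primes-prime support , primes-∣ support)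
    where
    2^t≤T : 2 ^ t ≤ T
    2^t≤T = 2^⌊log₂n⌋≤n (≤-trans (m^n>0 2 (threshold D a)) 2^threshold≤T)
  P≤2^L : P ≤ 2 ^ L
  P≤2^L = begin
    P               ≤⟨ ∣⇒≤ {{>-nonZero u>0}}
                           (∏distinctPrimes∣ ps (primes-unique support) (primes-prime support) (primes-∣ support)) ⟩
    u               ≤⟨ u≤[1+a]*n! ⟩
    suc a * n !     ≤⟨ [1+a]*n!≤2^[1+a+k*n] a n (t + 2) (≤-trans n≤2^t*4 (≤-reflexive (sym (^-distribˡ-+-* 2 t 2)))) ⟩
    2 ^ L           ∎

∣m/a-n/b∣<ε : ∀ m a n b (ε : ℚ) → .{{ℚ.Positive ε}} → n * suc a ≤ m * suc b →
              ↧ₙ ε * (m * suc b ∸ n * suc a) < suc a * suc b →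
              ℚ.∣ (ℤ.+ m ℚ./ suc a) - (ℤ.+ n ℚ./ suc b) ∣ <ℚ ε
∣m/a-n/b∣<ε m a n b ε@(mkℚ +[1+ k ] e-1 _) na≤mb ε*[mb∸na]<ab =
  ℚ.toℚᵘ-cancel-< (ℚᵘ.<-respˡ-≃ (ℚᵘ.≃-sym toℚᵘ-∣x-y∣) (ℚᵘ.*<*
    (subst (λ z → ℤ.+ ℤ.∣ z ∣ ℤ.* ℤ.+ suc e-1 ℤ.< +[1+ k ] ℤ.* ℤ.+ (A * B)) (sym numerator)
      (subst₂ ℤ._<_ (ℤ.pos-* (mb ∸ na) (suc e-1)) (ℤ.pos-* (suc k) (A * B)) (ℤ.+<+ num-bound)))))
  where
  A = suc a
  B = suc b
  mb = m * B
  na = n * A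
  x = ℤ.+ m ℚ./ A
  y = ℤ.+ n ℚ./ B
  toℚᵘ-∣x-y∣ : toℚᵘ ℚ.∣ x - y ∣ ≃ ℚᵘ.∣ mkℚᵘ (ℤ.+ m) a ℚᵘ.- mkℚᵘ (ℤ.+ n) b ∣
  toℚᵘ-∣x-y∣ = ℚᵘ.≃-trans (ℚ.toℚᵘ-homo-∣-∣ (x - y)) (ℚᵘ.∣-∣-cong
    (ℚᵘ.≃-trans (ℚ.toℚᵘ-homo-+ x (ℚ.- y))
      (ℚᵘ.+-cong (ℚ.toℚᵘ-fromℚᵘ (mkℚᵘ (ℤ.+ m) a))
                 (ℚᵘ.≃-trans (ℚ.toℚᵘ-homo‿- y) (ℚᵘ.-‿cong (ℚ.toℚᵘ-fromℚᵘ (mkℚᵘ (ℤ.+ n) b)))))))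
  numerator : ℤ.+ m ℤ.* ℤ.+ B ℤ.+ (ℤ.- (ℤ.+ n)) ℤ.* ℤ.+ A ≡ ℤ.+ (mb ∸ na)
  numerator = begin
    ℤ.+ m ℤ.* ℤ.+ B ℤ.+ (ℤ.- (ℤ.+ n)) ℤ.* ℤ.+ A   ≡⟨ cong₂ ℤ._+_ (sym (ℤ.pos-* m B)) (sym (ℤ.neg-distribˡ-* (ℤ.+ n) (ℤ.+ A))) ⟩
    ℤ.+ mb ℤ.+ ℤ.- (ℤ.+ n ℤ.* ℤ.+ A)            ≡⟨ cong (λ z → ℤ.+ mb ℤ.+ ℤ.- z) (sym (ℤ.pos-* n A)) ⟩
    ℤ.+ mb ℤ.+ ℤ.- (ℤ.+ na)                   ≡⟨ ℤ.m-n≡m⊖n mb na ⟩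
    mb ⊖ na                               ≡⟨ ℤ.⊖-≥ na≤mb ⟩
    ℤ.+ (mb ∸ na)                           ∎
    where open ≡-Reasoning
  num-bound : (mb ∸ na) * suc e-1 < suc k * (A * B)
  num-bound = <-≤-trans (subst (_< A * B) (*-comm (suc e-1) (mb ∸ na)) ε*[mb∸na]<ab) (m≤n*m (A * B) (suc k))

2*m≤n⇒m<n : ∀ {m n} → 0 < n → 2 * m ≤ n → m < n
2*m≤n⇒m<n {zero}  n>0 _      = n>0
2*m≤n⇒m<n {suc m} _   2m≤n =
  <-≤-trans (m<m+n (suc m) z<s) (≤-trans (≤-reflexive (cong (λ k → suc m + k) (sym (+-identityʳ (suc m))))) 2m≤n)

-- h(c) ≤ h(cu) ≤ h(c)·h(u), h(c) ≤ c and h(u) ≤ 1 + 1/D, so 0 ≤ h(cu) − h(c) ≤ c/D = 1/(2·↧ε) < ε.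
∣h[c*u]-h[c]∣<ε : ∀ c u (ε : ℚ) → .{{ℚ.Positive ε}} → 0 < c → 0 < u →
                  2 * c * ↧ₙ ε * σ u ≤ suc (2 * c * ↧ₙ ε) * u → ℚ.∣ h (c * u) - h c ∣ <ℚ ε
∣h[c*u]-h[c]∣<ε (suc c-1) (suc u-1) ε _ _ Dσu≤[1+D]u =
  ∣m/a-n/b∣<ε (σ (c * u)) (u-1 + c-1 * u) (σ c) c-1 ε σc*cu≤σcu*c q*gap<cu*c
  where
  open ≤-Reasoning
  c = suc c-1
  u = suc u-1
  q = ↧ₙ ε
  D = 2 * c * q
  V = σ u ∸ u
  swap : ∀ Y c u → Y * (c * u) ≡ c * (u * Y)
  swap = solve 3 (λ Y c u → Y :* (c :* u) := c :* (u :* Y)) refl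
  σc*cu≤σcu*c : σ c * (c * u) ≤ σ (c * u) * c
  σc*cu≤σcu*c = begin
    σ c * (c * u)    ≡⟨ swap (σ c) c u ⟩
    c * (u * σ c)    ≤⟨ *-monoʳ-≤ c (n*σ[m]≤σ[m*n] c u z<s z<s) ⟩
    c * σ (c * u)    ≡⟨ *-comm c (σ (c * u)) ⟩
    σ (c * u) * c    ∎
  gap≡c*[σcu∸uσc] : σ (c * u) * c ∸ σ c * (c * u) ≡ c * (σ (c * u) ∸ u * σ c)
  gap≡c*[σcu∸uσc] = trans (cong₂ _∸_ (*-comm (σ (c * u)) c) (swap (σ c) c u))
                          (sym (*-distribˡ-∸ c (σ (c * u)) (u * σ c)))
  σcu∸uσc≤σc*V : σ (c * u) ∸ u * σ c ≤ σ c * V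
  σcu∸uσc≤σc*V = begin
    σ (c * u) ∸ u * σ c    ≤⟨ ∸-monoˡ-≤ (u * σ c) (σ[m*n]≤σ[m]*σ[n] c u z<s z<s) ⟩
    σ c * σ u ∸ u * σ c    ≡⟨ cong (σ c * σ u ∸_) (*-comm u (σ c)) ⟩
    σ c * σ u ∸ σ c * u    ≡⟨ *-distribˡ-∸ (σ c) (σ u) u ⟨
    σ c * V                ∎
  2cqV≤u : 2 * (c * q * V) ≤ u
  2cqV≤u = begin
    2 * (c * q * V)          ≡⟨ assoc c q V ⟩
    D * V                    ≡⟨ *-distribˡ-∸ D (σ u) u ⟩
    D * σ u ∸ D * u          ≤⟨ ∸-monoˡ-≤ (D * u) Dσu≤[1+D]u ⟩
    (u + D * u) ∸ D * u      ≡⟨ m+n∸n≡m u (D * u) ⟩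
    u                        ∎
    where
    assoc : ∀ c q V → 2 * (c * q * V) ≡ 2 * c * q * V
    assoc = solve 3 (λ c q V → con 2 :* (c :* q :* V) := con 2 :* c :* q :* V) refl
  q*gap<cu*c : q * (σ (c * u) * c ∸ σ c * (c * u)) < (c * u) * c
  q*gap<cu*c = begin-strict
    q * (σ (c * u) * c ∸ σ c * (c * u))  ≡⟨ cong (q *_) gap≡c*[σcu∸uσc] ⟩
    q * (c * (σ (c * u) ∸ u * σ c))      ≤⟨ *-monoʳ-≤ q (*-monoʳ-≤ c (≤-trans σcu∸uσc≤σc*V (*-monoˡ-≤ V (σ[n]≤n*n c)))) ⟩
    q * (c * ((c * c) * V))              ≡⟨ e₁ q c V ⟩
    (c * c) * (c * q * V)                <⟨ *-monoʳ-< (c * c) (2*m≤n⇒m<n z<s 2cqV≤u) ⟩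
    (c * c) * u                          ≡⟨ e₂ c u ⟩
    (c * u) * c                          ∎
    where
    e₁ : ∀ q c V → q * (c * ((c * c) * V)) ≡ (c * c) * (c * q * V)
    e₁ = solve 3 (λ q c V → q :* (c :* ((c :* c) :* V)) := (c :* c) :* (c :* q :* V)) refl
    e₂ : ∀ c u → (c * c) * u ≡ (c * u) * c
    e₂ = solve 2 (λ c u → (c :* c) :* u := (c :* u) :* c) refl

m*n∣[m+n]! : ∀ m n → 0 < m → 0 < n → m * n ∣ (m + n) !
m*n∣[m+n]! m n m>0 n>0 = ∣-trans (*-pres-∣ (m∣n! m>0 ≤-refl) (m∣n! n>0 ≤-refl))
  (subst (λ k → m ! * k ! ∣ (m + n) !) (m+n∸m≡n m n) (k![n∸k]!∣n! (m≤m+n m n)))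

prime-factors>n∸m : ∀ {n m K u} → 0 < m → m ≤ n → n ! ≡ K * m → Coprime u K → ∀ {p} → Prime p → p ∣ u → n ∸ m < p
prime-factors>n∸m {n} {m} {K} m>0 m≤n n!≡K*m u⊥K {p} pp p∣u with n ∸ m <? p
... | yes n∸m<p = n∸m<p
... | no  n∸m≮p = ⊥-elim (<-irrefl (sym (u⊥K (p∣u , p∣K))) (prime>1 pp))
  where
  p∣K : p ∣ K
  p∣K = *-cancelʳ-∣ m {{>-nonZero m>0}} (subst (p * m ∣_) n!≡K*m
          (∣-trans (m*n∣[m+n]! p m (<-trans z<s (prime>1 pp)) m>0) (m≤n⇒m!∣n! (m≤o∸n⇒m+n≤o p m≤n (≮⇒≥ n∸m≮p)))))

coprime[1+m*n,n] : ∀ a K → Coprime (suc (a * K)) K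
coprime[1+m*n,n] a K {i} (i∣1+aK , i∣K) =
  ∣1⇒≡1 (∣m+n∣m⇒∣n (subst (i ∣_) (+-comm 1 (a * K)) i∣1+aK) (∣-trans i∣K (n∣m*n a)))

coprime[m*n∸1,n] : ∀ a K → 0 < a * K → Coprime (a * K ∸ 1) K
coprime[m*n∸1,n] a K aK>0 {i} (i∣aK∸1 , i∣K) =
  ∣1⇒≡1 (∣m+n∣m⇒∣n (subst (i ∣_) (sym (m∸n+n≡m aK>0)) (∣-trans i∣K (n∣m*n a))) i∣aK∸1)

module NearFactorial (a b c : ℕ) .{{_ : NonZero b}} (c>0 : 0 < c) (ε : ℚ) where

  D = 2 * c * ↧ₙ ε
  N = 2 ^ threshold D a + b * c + b * c

  b>0 : 0 < b
  b>0 = >-nonZero⁻¹ b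

  bc>0 : 0 < b * c
  bc>0 = *-mono-< b>0 c>0

  module _ {n} (N≤n : N ≤ n) where

    b*c∣n! : b * c ∣ n !
    b*c∣n! = ∣-trans (m*n∣[m+n]! b c b>0 c>0) (m≤n⇒m!∣n! (≤-trans b+c≤N N≤n))
      where
      b+c≤N : b + c ≤ N
      b+c≤N = ≤-trans (+-mono-≤ (m≤m*n b c {{>-nonZero c>0}}) (m≤n*m c b))
                      (≤-trans (m≤n+m (b * c + b * c) (2 ^ threshold D a)) (≤-reflexive (sym (+-assoc _ (b * c) (b * c)))))

    K = quotient b*c∣n!

    n!≡K*bc : n ! ≡ K * (b * c)
    n!≡K*bc = m∣n⇒n≡quotient*m b*c∣n!

    a*[n!/b]≡c*[a*K] : a * (n ! / b) ≡ c * (a * K)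
    a*[n!/b]≡c*[a*K] = trans (cong (a *_) n!/b≡K*c) (e a K c)
      where
      n!/b≡K*c : n ! / b ≡ K * c
      n!/b≡K*c = trans (cong (_/ b) (trans n!≡K*bc (e′ K b c))) (m*n/n≡m (K * c) b)
        where
        e′ : ∀ K b c → K * (b * c) ≡ K * c * b
        e′ = solve 3 (λ K b c → K :* (b :* c) := K :* c :* b) refl
      e : ∀ a K c → a * (K * c) ≡ c * (a * K)
      e = solve 3 (λ a K c → a :* (K :* c) := c :* (a :* K)) refl

    K≤n! : K ≤ n !
    K≤n! = subst (K ≤_) (sym n!≡K*bc) (m≤m*n K (b * c) {{>-nonZero bc>0}})

    K>0 : 0 < K
    K>0 = >-nonZero⁻¹ K {{m*n≢0⇒m≢0 K {{subst NonZero n!≡K*bc (n !≢0)}}}}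

    ∣h[c*u]-h[c]∣<ε-near-n! : ∀ {u} → .{{ℚ.Positive ε}} → 0 < u → Coprime u K → u ≤ suc a * n ! →
                              ℚ.∣ h (c * u) - h c ∣ <ℚ ε
    ∣h[c*u]-h[c]∣<ε-near-n! {u} u>0 u⊥K u≤[1+a]n! =
      ∣h[c*u]-h[c]∣<ε c u ε c>0 u>0
        (rough-abundancy D a n T u u>0 (prime-factors>n∸m bc>0 bc≤n n!≡K*bc u⊥K) u≤[1+a]n! 2^threshold≤T n≤2T)
      where
      T = n ∸ b * c
      2^threshold+bc≤T : 2 ^ threshold D a + b * c ≤ T
      2^threshold+bc≤T = m+n≤o⇒m≤o∸n _ N≤n
      bc≤n : b * c ≤ n
      bc≤n = ≤-trans (m≤n+m _ _) N≤n
      2^threshold≤T : 2 ^ threshold D a ≤ T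
      2^threshold≤T = ≤-trans (m≤m+n _ (b * c)) 2^threshold+bc≤T
      n≤2T : n ≤ 2 * T
      n≤2T = begin
        n                  ≡⟨ m∸n+n≡m bc≤n ⟨
        T + b * c          ≤⟨ +-monoʳ-≤ T (≤-trans (m≤n+m (b * c) _) 2^threshold+bc≤T) ⟩
        T + T              ≡⟨ cong (T +_) (+-identityʳ T) ⟨
        2 * T              ∎
        where open ≤-Reasoning

    h[a*n!/b+c]≈h[c] : .{{ℚ.Positive ε}} → ℚ.∣ h (a * (n ! / b) + c) - h c ∣ <ℚ ε
    h[a*n!/b+c]≈h[c] = subst (λ m → ℚ.∣ h m - h c ∣ <ℚ ε) (sym a*[n!/b]+c≡c*[1+aK])
      (∣h[c*u]-h[c]∣<ε-near-n! z<s (coprime[1+m*n,n] a K) 1+aK≤[1+a]n!)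
      where
      a*[n!/b]+c≡c*[1+aK] : a * (n ! / b) + c ≡ c * suc (a * K)
      a*[n!/b]+c≡c*[1+aK] = trans (cong (_+ c) a*[n!/b]≡c*[a*K]) (trans (+-comm (c * (a * K)) c) (sym (*-suc c (a * K))))
      1+aK≤[1+a]n! : suc (a * K) ≤ suc a * n !
      1+aK≤[1+a]n! = ≤-trans (+-monoˡ-≤ (a * K) K>0) (*-monoʳ-≤ (suc a) K≤n!)

    h[a*n!/b∸c]≈h[c] : .{{ℚ.Positive ε}} → c < a * (n ! / b) → ℚ.∣ h (a * (n ! / b) ∸ c) - h c ∣ <ℚ ε
    h[a*n!/b∸c]≈h[c] c<a*[n!/b] = subst (λ m → ℚ.∣ h m - h c ∣ <ℚ ε) (sym a*[n!/b]∸c≡c*[aK∸1])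
      (∣h[c*u]-h[c]∣<ε-near-n! (m<n⇒0<n∸m 1<aK) (coprime[m*n∸1,n] a K (<-trans z<s 1<aK)) aK∸1≤[1+a]n!)
      where
      1<aK : 1 < a * K
      1<aK = *-cancelˡ-< c 1 (a * K) (subst (_< c * (a * K)) (sym (*-identityʳ c)) (subst (c <_) a*[n!/b]≡c*[a*K] c<a*[n!/b]))
      a*[n!/b]∸c≡c*[aK∸1] : a * (n ! / b) ∸ c ≡ c * (a * K ∸ 1)
      a*[n!/b]∸c≡c*[aK∸1] = trans (cong (_∸ c) a*[n!/b]≡c*[a*K])
        (trans (cong (c * (a * K) ∸_) (sym (*-identityʳ c))) (sym (*-distribˡ-∸ c (a * K) 1)))
      aK∸1≤[1+a]n! : a * K ∸ 1 ≤ suc a * n !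
      aK∸1≤[1+a]n! = ≤-trans (m∸n≤m (a * K) 1) (≤-trans (*-monoʳ-≤ a K≤n!) (*-monoˡ-≤ (n !) (n≤1+n a)))

-- Imported last: as a closed operator it makes expressions such as g ∣ m × e ∣ n ambiguous.
open import Data.Rational using (∣_∣)

theorem8 : (a b c : ℕ) → .{{_ : NonZero b}} → 0 < a → 0 < b → 0 < c →
  ((ε : ℚ) → 0ℚ <ℚ ε → ∃[ N ] ((n : ℕ) → N ≤ n → b ∣ (n !) →
      0 < a * ((n !) / b) + c →
      ∣ h (a * ((n !) / b) + c) - h c ∣ <ℚ ε))
  ×
  ((ε : ℚ) → 0ℚ <ℚ ε → ∃[ N ] ((n : ℕ) → N ≤ n → b ∣ (n !) →
      c < a * ((n !) / b) →
      ∣ h (a * ((n !) / b) ∸ c) - h c ∣ <ℚ ε))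
theorem8 a b c _ _ c>0 =
  (λ ε 0<ε → N ε , λ n N≤n _ _ → h[a*n!/b+c]≈h[c] ε N≤n {{ℚ.positive 0<ε}}) ,
  (λ ε 0<ε → N ε , λ n N≤n _   → h[a*n!/b∸c]≈h[c] ε N≤n {{ℚ.positive 0<ε}})
  where open NearFactorial a b c c>0
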